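{- Fix $0\leq p\leq 1$ and let $G$ be the random spanning subgraph of $Q_n$ in which each edge of $Q_n$ is kept independently with probability $p$. Let $A\subseteq E(Q_n)$ and let $B_1,\dots,B_k\subseteq E(Q_n)$ be pairwise disjoint. Let $P$ be the set of spanning subgraphs $H$ of $Q_n$ with $B_i\not\subseteq E(H)$ for all $1\leq i\leq k$, and suppose that $A\subseteq E(\tilde H)$ for some $H\in P$. Then $\Pr[G\in P\mid A\subseteq E(\tilde G)]\leq \Pr[G\in P]$.
   Context: $Q_n$ is the $n$-cube (graph on $\{0,1\}^n$, $x,y$ adjacent iff they differ in exactly one component). For a spanning subgraph $H$ of $Q_n$, an embedding of $H$ is a permutation $\pi$ of $\{0,1\}^n$ with $\pi(x)\pi(y)\in E(Q_n)$ for all $xy\in E(H)$; an edge $xy\in E(Q_n)$ is solid in $H$ if $\pi(x)\pi(y)\in E(Q_n)$ for every embedding $\pi$ of $H$; $\tilde H$ is obtained from $H$ by adding all edges of $Q_n$ solid in $H$.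
   Formalization: The edge-retention probability p is taken over the rationals in [0,1]. -}

module Defs where

open import Data.Nat using (ℕ; zero; suc)
open import Data.Bool using (Bool; true; false; if_then_else_; _xor_)
open import Data.Fin using (Fin)
open import Data.Vec using (Vec; []; _∷_)
open import Data.List using (List; []; _∷_; [_]; map; _++_; concatMap; foldr)
open import Data.Product using (_×_; _,_; proj₁; proj₂)
open import Data.Sum using (_⊎_)
open import Data.Rational using (ℚ; 0ℚ; 1ℚ; _+_; _*_; _-_)
open import Relation.Binary.PropositionalEquality using (_≡_; _≢_)
open import Relation.Nullary using (¬_)
open import Function.Bundles using (_↔_; Inverse)

Vertex : ℕ → Set
Vertex n = Vec Bool n

hamming : ∀ {n} → Vertex n → Vertex n → ℕ
hamming [] [] = 0
hamming (a ∷ x) (b ∷ y) = (if a xor b then 1 else 0) Data.Nat.+ hamming x y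

Adj : ∀ {n} → Vertex n → Vertex n → Set
Adj x y = hamming x y ≡ 1

-- Edges of Q_n, each edge of Q_n represented exactly once:
-- Q_{n+1} = (0 × Q_n) ∪ (1 × Q_n) ∪ perfect matching {0v,1v}.
data Edge : ℕ → Set where
  here  : ∀ {n} → Vertex n → Edge (suc n)
  there : ∀ {n} → Bool → Edge n → Edge (suc n)

ends : ∀ {n} → Edge n → Vertex n × Vertex n
ends (here v) = (false ∷ v) , (true ∷ v)
ends (there b e) = (b ∷ proj₁ (ends e)) , (b ∷ proj₂ (ends e))

EdgeSet : ℕ → Set
EdgeSet n = Edge n → Bool

Subgraph : ℕ → Set
Subgraph = EdgeSet

_∈E_ : ∀ {n} → Edge n → EdgeSet n → Set
e ∈E S = S e ≡ true

_⊆E_ : ∀ {n} → EdgeSet n → EdgeSet n → Set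
S ⊆E T = ∀ e → e ∈E S → e ∈E T

IsEmbedding : ∀ {n} → Subgraph n → (Vertex n ↔ Vertex n) → Set
IsEmbedding H π = ∀ e → e ∈E H →
  Adj (Inverse.to π (proj₁ (ends e))) (Inverse.to π (proj₂ (ends e)))

Solid : ∀ {n} → Subgraph n → Edge n → Set
Solid H e = ∀ (π : Vertex _ ↔ Vertex _) → IsEmbedding H π →
  Adj (Inverse.to π (proj₁ (ends e))) (Inverse.to π (proj₂ (ends e)))

_∈Ẽ_ : ∀ {n} → Edge n → Subgraph n → Set
e ∈Ẽ H = e ∈E H ⊎ Solid H e

_⊆Ẽ_ : ∀ {n} → EdgeSet n → Subgraph n → Set
A ⊆Ẽ H = ∀ e → e ∈E A → e ∈Ẽ H

InP : ∀ {n k} → (Fin k → EdgeSet n) → Subgraph n → Set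
InP B H = ∀ i → ¬ (B i ⊆E H)

PairwiseDisjoint : ∀ {n k} → (Fin k → EdgeSet n) → Set
PairwiseDisjoint B = ∀ i j → i ≢ j → ∀ e → e ∈E B i → B j e ≡ false

allVertices : ∀ n → List (Vertex n)
allVertices zero = [ [] ]
allVertices (suc n) = map (false ∷_) (allVertices n) ++ map (true ∷_) (allVertices n)

allEdges : ∀ n → List (Edge n)
allEdges zero = []
allEdges (suc n) = map here (allVertices n)
  ++ map (there false) (allEdges n) ++ map (there true) (allEdges n)

allVertexPreds : ∀ n → List (Vertex n → Bool)
allVertexPreds zero = (λ _ → false) ∷ (λ _ → true) ∷ []
allVertexPreds (suc n) =
  concatMap (λ f → map (λ g → join f g) (allVertexPreds n)) (allVertexPreds n)
  where
  join : (Vertex n → Bool) → (Vertex n → Bool) → Vertex (suc n) → Bool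
  join f g (b ∷ v) = if b then g v else f v

-- all spanning subgraphs of Q_n (each exactly once, up to extensionality)
allSubgraphs : ∀ n → List (Subgraph n)
allSubgraphs zero = (λ ()) ∷ []
allSubgraphs (suc n) =
  concatMap (λ f → concatMap (λ g → map (λ h → comb f g h) (allSubgraphs n))
                             (allSubgraphs n))
            (allVertexPreds n)
  where
  comb : (Vertex n → Bool) → Subgraph n → Subgraph n → Subgraph (suc n)
  comb f g h (here v) = f v
  comb f g h (there false e) = g e
  comb f g h (there true e) = h e

sumℚ : List ℚ → ℚ
sumℚ = foldr _+_ 0ℚ

prodℚ : List ℚ → ℚ
prodℚ = foldr _*_ 1ℚ

weight : ∀ {n} → ℚ → Subgraph n → ℚ
weight {n} p H = prodℚ (map (λ e → if H e then p else 1ℚ - p) (allEdges n))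

Pr : ∀ n → ℚ → (Subgraph n → Bool) → ℚ
Pr n p χ = sumℚ (map (λ H → if χ H then weight p H else 0ℚ) (allSubgraphs n))

{-# OPTIONS --safe #-}
-- Harris's inequality: for a product of Bernoulli measures, a decreasing and an
-- increasing function are negatively correlated. On a two-point space this is
-- the covariance identity E[fg] − E[f]E[g] = p(1−p)(f₁−f₀)(g₁−g₀), and the
-- inequality passes to products and to order-preserving pushforwards. The random
-- subgraph of Q_(n+1) is such a pushforward: its edges are the matching edges
-- {0v,1v} (a random subset of the vertices of Q_n) and two independent copies of
-- Q_n. The event P is decreasing in H (deleting edges keeps every Bᵢ ⊄ E(H)),
-- and A ⊆ E(H̃) is increasing (an embedding of a supergraph of H is one of H, so
-- solid edges stay solid).
module Submission where

open import Defs
open import Level using (0ℓ)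
open import Data.Nat using (ℕ; zero; suc)
open import Data.Fin using (Fin)
open import Data.Bool using (Bool; true; false; if_then_else_; _∧_)
open import Data.Product using (Σ; _×_; _,_)
open import Data.Sum using (inj₁; inj₂)
open import Data.List using (List; []; _∷_; map; _++_; concatMap)
open import Data.List.Properties using (map-++; map-∘; map-cong)
open import Data.List.Relation.Binary.Pointwise as Pointwise
  using (Pointwise; []; _∷_; concat⁺; map⁺)
open import Data.Vec using ([]; _∷_)
open import Data.Rational using (ℚ; 0ℚ; 1ℚ; _≤_; _≥_; _+_; _*_; _-_; -_; nonNegative)
open import Data.Rational.Properties
  using (≤-refl; ≤-reflexive; ≤-trans; ≤-antisym; +-assoc; +-identityˡ; +-identityʳ;
         +-inverseʳ; *-assoc; *-identityˡ; *-identityʳ; *-zeroˡ; *-zeroʳ; *-distribˡ-+;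
         +-mono-≤; +-monoˡ-≤; +-monoʳ-≤; *-monoˡ-≤-nonNeg; nonNeg*nonNeg⇒nonNeg;
         nonNegative⁻¹; module ≤-Reasoning)
open import Data.Rational.Solver using (module +-*-Solver)
open import Function using (_∘_)
open import Relation.Binary.Core using (Rel; _Preserves_⟶_)
open import Relation.Binary.Definitions using (Reflexive)
open import Relation.Binary.PropositionalEquality
  using (_≡_; refl; sym; trans; cong; cong₂; subst₂; _≗_; module ≡-Reasoning)
open import Relation.Nullary using (Dec; yes; no; contradiction)
open import Relation.Nullary.Decidable using (isYes)

private variable
  X Y D : Set

0≤q-p : ∀ {p q} → p ≤ q → 0ℚ ≤ q - p
0≤q-p {p} p≤q = ≤-trans (≤-reflexive (sym (+-inverseʳ p))) (+-monoˡ-≤ (- p) p≤q)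

0≤p*q : ∀ {p q} → 0ℚ ≤ p → 0ℚ ≤ q → 0ℚ ≤ p * q
0≤p*q {p} {q} 0≤p 0≤q =
  nonNegative⁻¹ (p * q) {{nonNeg*nonNeg⇒nonNeg p {{nonNegative 0≤p}} q {{nonNegative 0≤q}}}}

prodℚ-++ : (xs ys : List ℚ) → prodℚ (xs ++ ys) ≡ prodℚ xs * prodℚ ys
prodℚ-++ []       ys = sym (*-identityˡ _)
prodℚ-++ (x ∷ xs) ys = trans (cong (x *_) (prodℚ-++ xs ys)) (sym (*-assoc x _ _))

Pointwise-map : {R : Rel Y 0ℓ} {f g : X → Y} →
  (∀ x → R (f x) (g x)) → (xs : List X) → Pointwise R (map f xs) (map g xs)
Pointwise-map r xs = map⁺ _ _ (Pointwise.refl (λ {x} → r x))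

weightedSum : (X → ℚ) → List X → (X → ℚ) → ℚ
weightedSum w []       φ = 0ℚ
weightedSum w (x ∷ xs) φ = w x * φ x + weightedSum w xs φ

module _ {w : X → ℚ} where

  weightedSum-++ : ∀ xs ys {φ} →
    weightedSum w (xs ++ ys) φ ≡ weightedSum w xs φ + weightedSum w ys φ
  weightedSum-++ []       ys = sym (+-identityˡ _)
  weightedSum-++ (x ∷ xs) ys {φ} =
    trans (cong (w x * φ x +_) (weightedSum-++ xs ys))
          (sym (+-assoc (w x * φ x) (weightedSum w xs φ) (weightedSum w ys φ)))

  weightedSum-scale : ∀ a xs {φ} →
    weightedSum (λ x → a * w x) xs φ ≡ a * weightedSum w xs φ
  weightedSum-scale a []       = sym (*-zeroʳ a)
  weightedSum-scale a (x ∷ xs) {φ} = begin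
    (a * w x) * φ x + weightedSum (λ x → a * w x) xs φ
      ≡⟨ cong₂ _+_ (*-assoc a (w x) (φ x)) (weightedSum-scale a xs) ⟩
    a * (w x * φ x) + a * weightedSum w xs φ
      ≡⟨ *-distribˡ-+ a _ _ ⟨
    a * weightedSum w (x ∷ xs) φ ∎
    where open ≡-Reasoning

  weightedSum-mono : (∀ x → 0ℚ ≤ w x) → ∀ xs {φ ψ} →
    (∀ x → φ x ≤ ψ x) → weightedSum w xs φ ≤ weightedSum w xs ψ
  weightedSum-mono 0≤w []       φ≤ψ = ≤-refl
  weightedSum-mono 0≤w (x ∷ xs) φ≤ψ =
    +-mono-≤ (*-monoˡ-≤-nonNeg (w x) {{nonNegative (0≤w x)}} (φ≤ψ x))
             (weightedSum-mono 0≤w xs φ≤ψ)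

  weightedSum-cong-Pointwise : {R : Rel X 0ℓ} {φ : X → ℚ} →
    w Preserves R ⟶ _≡_ → φ Preserves R ⟶ _≡_ →
    ∀ {xs ys} → Pointwise R xs ys → weightedSum w xs φ ≡ weightedSum w ys φ
  weightedSum-cong-Pointwise w-resp φ-resp []           = refl
  weightedSum-cong-Pointwise w-resp φ-resp (r ∷ xs∼ys) =
    cong₂ _+_ (cong₂ _*_ (w-resp r) (φ-resp r))
              (weightedSum-cong-Pointwise w-resp φ-resp xs∼ys)

weightedSum-map : {w : Y → ℚ} {v : X → ℚ} {c : X → Y} {a : ℚ} →
  (∀ x → w (c x) ≡ a * v x) → ∀ xs {φ} →
  weightedSum w (map c xs) φ ≡ a * weightedSum v xs (φ ∘ c)
weightedSum-map {a = a} w∘c≡a*v []       = sym (*-zeroʳ a)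
weightedSum-map {w = w} {v} {c} {a} w∘c≡a*v (x ∷ xs) {φ} = begin
  w (c x) * φ (c x) + weightedSum w (map c xs) φ
    ≡⟨ cong₂ _+_ (cong (_* φ (c x)) (w∘c≡a*v x))
                 (weightedSum-map {w = w} {v} {c} {a} w∘c≡a*v xs) ⟩
  (a * v x) * φ (c x) + a * weightedSum v xs (φ ∘ c)
    ≡⟨ cong (_+ a * weightedSum v xs (φ ∘ c)) (*-assoc a (v x) (φ (c x))) ⟩
  a * (v x * φ (c x)) + a * weightedSum v xs (φ ∘ c)
    ≡⟨ *-distribˡ-+ a _ _ ⟨
  a * weightedSum v (x ∷ xs) (φ ∘ c) ∎
  where open ≡-Reasoning

weightedSum-concatMap : {w : Y → ℚ} {u ψ : X → ℚ} {F : X → List Y} {φ : Y → ℚ} →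
  (∀ x → weightedSum w (F x) φ ≡ u x * ψ x) → ∀ xs →
  weightedSum w (concatMap F xs) φ ≡ weightedSum u xs ψ
weightedSum-concatMap sumF≡ []       = refl
weightedSum-concatMap {F = F} sumF≡ (x ∷ xs) =
  trans (weightedSum-++ (F x) (concatMap F xs))
        (cong₂ _+_ (sumF≡ x) (weightedSum-concatMap sumF≡ xs))

record OrderedSpace : Set₁ where
  field
    Carrier : Set
    _≼_     : Rel Carrier 0ℓ
    ≼-refl  : Reflexive _≼_
    𝔼       : (Carrier → ℚ) → ℚ
    𝔼-mono  : ∀ {φ ψ} → (∀ x → φ x ≤ ψ x) → 𝔼 φ ≤ 𝔼 ψ

  𝔼-cong : ∀ {φ ψ} → φ ≗ ψ → 𝔼 φ ≡ 𝔼 ψ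
  𝔼-cong φ≗ψ = ≤-antisym (𝔼-mono (≤-reflexive ∘ φ≗ψ)) (𝔼-mono (≤-reflexive ∘ sym ∘ φ≗ψ))

  Invariant : (Carrier → ℚ) → Set
  Invariant φ = ∀ {x y} → x ≼ y → y ≼ x → φ x ≡ φ y

  antitone⇒invariant : ∀ {f} → f Preserves _≼_ ⟶ _≥_ → Invariant f
  antitone⇒invariant f↓ x≼y y≼x = ≤-antisym (f↓ y≼x) (f↓ x≼y)

  monotone⇒invariant : ∀ {g} → g Preserves _≼_ ⟶ _≤_ → Invariant g
  monotone⇒invariant g↑ x≼y y≼x = ≤-antisym (g↑ x≼y) (g↑ y≼x)

  Harris : Set
  Harris = ∀ f g → f Preserves _≼_ ⟶ _≥_ → g Preserves _≼_ ⟶ _≤_ →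
    𝔼 (λ x → f x * g x) ≤ 𝔼 f * 𝔼 g

open OrderedSpace using (Carrier; 𝔼; 𝔼-cong; Invariant; Harris)

_⊗_ : OrderedSpace → OrderedSpace → OrderedSpace
S ⊗ T = record
  { Carrier = S.Carrier × T.Carrier
  ; _≼_     = λ (s , t) (s′ , t′) → s S.≼ s′ × t T.≼ t′
  ; ≼-refl  = S.≼-refl , T.≼-refl
  ; 𝔼       = λ φ → S.𝔼 (λ s → T.𝔼 (λ t → φ (s , t)))
  ; 𝔼-mono  = λ φ≤ψ → S.𝔼-mono (λ s → T.𝔼-mono (λ t → φ≤ψ (s , t)))
  }
  where
  module S = OrderedSpace S
  module T = OrderedSpace T

harris-⊗ : (S T : OrderedSpace) → Harris S → Harris T → Harris (S ⊗ T)
harris-⊗ S T harrisS harrisT f g f↓ g↑ = begin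
  S.𝔼 (λ s → T.𝔼 (λ t → f (s , t) * g (s , t)))
    ≤⟨ S.𝔼-mono (λ s → harrisT (λ t → f (s , t)) (λ t → g (s , t))
                   (λ t≼t′ → f↓ (S.≼-refl , t≼t′)) (λ t≼t′ → g↑ (S.≼-refl , t≼t′))) ⟩
  S.𝔼 (λ s → F s * G s)
    ≤⟨ harrisS F G (λ s≼s′ → T.𝔼-mono (λ t → f↓ (s≼s′ , T.≼-refl)))
                   (λ s≼s′ → T.𝔼-mono (λ t → g↑ (s≼s′ , T.≼-refl))) ⟩
  S.𝔼 F * S.𝔼 G ∎
  where
  module S = OrderedSpace S
  module T = OrderedSpace T
  open ≤-Reasoning
  F G : S.Carrier → ℚ
  F s = T.𝔼 (λ t → f (s , t))
  G s = T.𝔼 (λ t → g (s , t))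

harris-pushforward : (S T : OrderedSpace) (c : Carrier S → Carrier T) →
  c Preserves OrderedSpace._≼_ S ⟶ OrderedSpace._≼_ T →
  (∀ φ → Invariant T φ → 𝔼 T φ ≡ 𝔼 S (φ ∘ c)) →
  Harris S → Harris T
harris-pushforward S T c c-mono 𝔼T≡ harrisS f g f↓ g↑ = begin
  T.𝔼 (λ y → f y * g y)
    ≡⟨ 𝔼T≡ _ (λ x≼y y≼x → cong₂ _*_ (T.antitone⇒invariant f↓ x≼y y≼x)
                                    (T.monotone⇒invariant g↑ x≼y y≼x)) ⟩
  S.𝔼 (λ x → f (c x) * g (c x))
    ≤⟨ harrisS (f ∘ c) (g ∘ c) (f↓ ∘ c-mono) (g↑ ∘ c-mono) ⟩
  S.𝔼 (f ∘ c) * S.𝔼 (g ∘ c)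
    ≡⟨ cong₂ _*_ (𝔼T≡ f (T.antitone⇒invariant f↓)) (𝔼T≡ g (T.monotone⇒invariant g↑)) ⟨
  T.𝔼 f * T.𝔼 g ∎
  where
  module S = OrderedSpace S
  module T = OrderedSpace T
  open ≤-Reasoning

open +-*-Solver using (solve; _:=_; _:+_; _:*_; _:-_; con)

two-point-harris : ∀ {p f₀ f₁ g₀ g₁} → 0ℚ ≤ p → p ≤ 1ℚ → f₁ ≤ f₀ → g₀ ≤ g₁ →
  (1ℚ - p) * (f₀ * g₀) + p * (f₁ * g₁)
    ≤ ((1ℚ - p) * f₀ + p * f₁) * ((1ℚ - p) * g₀ + p * g₁)
two-point-harris {p} {f₀} {f₁} {g₀} {g₁} 0≤p p≤1 f₁≤f₀ g₀≤g₁ = begin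
  𝔼[fg]               ≡⟨ +-identityʳ 𝔼[fg] ⟨
  𝔼[fg] + 0ℚ          ≤⟨ +-monoʳ-≤ 𝔼[fg] 0≤cov ⟩
  𝔼[fg] + cov         ≡⟨ covariance p f₀ f₁ g₀ g₁ ⟩
  𝔼[f] * 𝔼[g] ∎
  where
  open ≤-Reasoning
  𝔼[fg] 𝔼[f] 𝔼[g] cov : ℚ
  𝔼[fg] = (1ℚ - p) * (f₀ * g₀) + p * (f₁ * g₁)
  𝔼[f]  = (1ℚ - p) * f₀ + p * f₁
  𝔼[g]  = (1ℚ - p) * g₀ + p * g₁
  cov   = ((1ℚ - p) * p) * ((f₀ - f₁) * (g₁ - g₀))
  0≤cov : 0ℚ ≤ cov
  0≤cov = 0≤p*q (0≤p*q (0≤q-p p≤1) 0≤p) (0≤p*q (0≤q-p f₁≤f₀) (0≤q-p g₀≤g₁))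
  covariance : ∀ p f₀ f₁ g₀ g₁ →
    (1ℚ - p) * (f₀ * g₀) + p * (f₁ * g₁) + ((1ℚ - p) * p) * ((f₀ - f₁) * (g₁ - g₀))
      ≡ ((1ℚ - p) * f₀ + p * f₁) * ((1ℚ - p) * g₀ + p * g₁)
  covariance = solve 5 (λ p f₀ f₁ g₀ g₁ →
    (con 1ℚ :- p) :* (f₀ :* g₀) :+ p :* (f₁ :* g₁)
      :+ ((con 1ℚ :- p) :* p) :* ((f₀ :- f₁) :* (g₁ :- g₀))
    := ((con 1ℚ :- p) :* f₀ :+ p :* f₁) :* ((con 1ℚ :- p) :* g₀ :+ p :* g₁)) refl

_⊆ᵇ_ : (D → Bool) → (D → Bool) → Set
F ⊆ᵇ G = ∀ d → F d ≡ true → G d ≡ true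

≗⇒⊆ᵇ : {F G : D → Bool} → F ≗ G → F ⊆ᵇ G
≗⇒⊆ᵇ F≗G d Fd = trans (sym (F≗G d)) Fd

bernoulliWeight : ℚ → List D → (D → Bool) → ℚ
bernoulliWeight p ds F = prodℚ (map (λ d → if F d then p else 1ℚ - p) ds)

joinVP : ∀ {n} → (Vertex n → Bool) × (Vertex n → Bool) → Vertex (suc n) → Bool
joinVP (f , g) (false ∷ v) = f v
joinVP (f , g) (true ∷ v)  = g v

joinSubgraph : ∀ {n} → (Vertex n → Bool) × (Subgraph n × Subgraph n) → Subgraph (suc n)
joinSubgraph (f , g , h) (here v)        = f v
joinSubgraph (f , g , h) (there false e) = g e
joinSubgraph (f , g , h) (there true e)  = h e

joinVP-mono : ∀ {n} {f f′ g g′ : Vertex n → Bool} → f ⊆ᵇ f′ → g ⊆ᵇ g′ →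
  joinVP (f , g) ⊆ᵇ joinVP (f′ , g′)
joinVP-mono f⊆f′ g⊆g′ (false ∷ v) = f⊆f′ v
joinVP-mono f⊆f′ g⊆g′ (true ∷ v)  = g⊆g′ v

joinSubgraph-mono : ∀ {n} {f f′ : Vertex n → Bool} {g g′ h h′ : Subgraph n} →
  f ⊆ᵇ f′ → g ⊆ᵇ g′ → h ⊆ᵇ h′ → joinSubgraph (f , g , h) ⊆ᵇ joinSubgraph (f′ , g′ , h′)
joinSubgraph-mono f⊆f′ g⊆g′ h⊆h′ (here v)        = f⊆f′ v
joinSubgraph-mono f⊆f′ g⊆g′ h⊆h′ (there false e) = g⊆g′ e
joinSubgraph-mono f⊆f′ g⊆g′ h⊆h′ (there true e)  = h⊆h′ e

-- The combining maps of the enumerations in Defs are local to 'where' blocks,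
-- so the enumerations are compared with joinVP and joinSubgraph only pointwise.
allVertexPreds-suc : ∀ n → Pointwise _≗_ (allVertexPreds (suc n))
  (concatMap (λ f → map (λ g → joinVP (f , g)) (allVertexPreds n)) (allVertexPreds n))
allVertexPreds-suc n = concat⁺ (Pointwise-map (λ f → Pointwise-map (λ g →
  λ { (false ∷ v) → refl ; (true ∷ v) → refl })
  (allVertexPreds n)) (allVertexPreds n))

allSubgraphs-suc : ∀ n → Pointwise _≗_ (allSubgraphs (suc n))
  (concatMap (λ f → concatMap (λ g → map (λ h → joinSubgraph (f , g , h))
    (allSubgraphs n)) (allSubgraphs n)) (allVertexPreds n))
allSubgraphs-suc n = concat⁺ (Pointwise-map (λ f → concat⁺ (Pointwise-map (λ g →
  Pointwise-map (λ h →
    λ { (here v) → refl ; (there false e) → refl ; (there true e) → refl })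
  (allSubgraphs n)) (allSubgraphs n))) (allVertexPreds n))

module _ (p : ℚ) where

  bernoulliWeight-++ : ∀ {D : Set} (ds es : List D) F →
    bernoulliWeight p (ds ++ es) F ≡ bernoulliWeight p ds F * bernoulliWeight p es F
  bernoulliWeight-++ {D} ds es F =
    trans (cong prodℚ (map-++ weightOf ds es)) (prodℚ-++ (map weightOf ds) (map weightOf es))
    where
    weightOf : D → ℚ
    weightOf d = if F d then p else 1ℚ - p

  bernoulliWeight-map : ∀ (c : X → D) xs F →
    bernoulliWeight p (map c xs) F ≡ bernoulliWeight p xs (F ∘ c)
  bernoulliWeight-map c xs F = cong prodℚ (sym (map-∘ xs))

  bernoulliWeight-cong : ∀ (ds : List D) {F G} → F ≗ G →
    bernoulliWeight p ds F ≡ bernoulliWeight p ds G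
  bernoulliWeight-cong ds F≗G =
    cong prodℚ (map-cong (λ d → cong (λ b → if b then p else 1ℚ - p) (F≗G d)) ds)

  bernoulliWeight-joinVP : ∀ {n} f g →
    bernoulliWeight p (allVertices (suc n)) (joinVP (f , g))
      ≡ bernoulliWeight p (allVertices n) f * bernoulliWeight p (allVertices n) g
  bernoulliWeight-joinVP {n} f g =
    trans (bernoulliWeight-++ (map (false ∷_) V) (map (true ∷_) V) (joinVP (f , g)))
          (cong₂ _*_ (bernoulliWeight-map (false ∷_) V (joinVP (f , g)))
                     (bernoulliWeight-map (true ∷_) V (joinVP (f , g))))
    where
    V : List (Vertex n)
    V = allVertices n

  weight-joinSubgraph : ∀ {n} f g h →
    weight p (joinSubgraph (f , g , h))
      ≡ bernoulliWeight p (allVertices n) f * (weight p g * weight p h)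
  weight-joinSubgraph {n} f g h =
    trans (bernoulliWeight-++ (map here V) (map (there false) E ++ map (there true) E) J)
          (cong₂ _*_ (bernoulliWeight-map here V J)
            (trans (bernoulliWeight-++ (map (there false) E) (map (there true) E) J)
                   (cong₂ _*_ (bernoulliWeight-map (there false) E J)
                              (bernoulliWeight-map (there true) E J))))
    where
    V : List (Vertex n)
    V = allVertices n
    E : List (Edge n)
    E = allEdges n
    J : Subgraph (suc n)
    J = joinSubgraph (f , g , h)

module Bernoulli (p : ℚ) (0≤p : 0ℚ ≤ p) (p≤1 : p ≤ 1ℚ) where

  bernoulliWeight-nonNeg : (ds : List D) (F : D → Bool) → 0ℚ ≤ bernoulliWeight p ds F
  bernoulliWeight-nonNeg []       F = nonNegative⁻¹ 1ℚ
  bernoulliWeight-nonNeg (d ∷ ds) F = 0≤p*q (0≤weight (F d)) (bernoulliWeight-nonNeg ds F)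
    where
    0≤weight : ∀ b → 0ℚ ≤ (if b then p else 1ℚ - p)
    0≤weight true  = 0≤p
    0≤weight false = 0≤q-p p≤1

  bernoulliSpace : List D → List (D → Bool) → OrderedSpace
  bernoulliSpace {D} ds Fs = record
    { Carrier = D → Bool
    ; _≼_     = _⊆ᵇ_
    ; ≼-refl  = λ d Fd → Fd
    ; 𝔼       = weightedSum (bernoulliWeight p ds) Fs
    ; 𝔼-mono  = weightedSum-mono (bernoulliWeight-nonNeg ds) Fs
    }

  𝔼-bernoulli-Pointwise : ∀ {ds : List D} {Fs Gs} {φ} → Invariant (bernoulliSpace ds Fs) φ →
    Pointwise _≗_ Fs Gs →
    weightedSum (bernoulliWeight p ds) Fs φ ≡ weightedSum (bernoulliWeight p ds) Gs φ
  𝔼-bernoulli-Pointwise {ds = ds} φ-inv =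
    weightedSum-cong-Pointwise (bernoulliWeight-cong p ds)
      (λ F≗G → φ-inv (≗⇒⊆ᵇ F≗G) (≗⇒⊆ᵇ (sym ∘ F≗G)))

  vertexPredSpace : ℕ → OrderedSpace
  vertexPredSpace n = bernoulliSpace (allVertices n) (allVertexPreds n)

  subgraphSpace : ℕ → OrderedSpace
  subgraphSpace n = bernoulliSpace (allEdges n) (allSubgraphs n)

  vertexPredSpace-suc : ∀ n φ → Invariant (vertexPredSpace (suc n)) φ →
    𝔼 (vertexPredSpace (suc n)) φ ≡ 𝔼 (vertexPredSpace n ⊗ vertexPredSpace n) (φ ∘ joinVP)
  vertexPredSpace-suc n φ φ-inv = begin
    weightedSum wV′ (allVertexPreds (suc n)) φ
      ≡⟨ 𝔼-bernoulli-Pointwise {ds = allVertices (suc n)} φ-inv (allVertexPreds-suc n) ⟩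
    weightedSum wV′ (concatMap (λ f → map (λ g → joinVP (f , g)) VP) VP) φ
      ≡⟨ weightedSum-concatMap (λ f →
           weightedSum-map {v = wV} {a = wV f} (bernoulliWeight-joinVP p f) VP) VP ⟩
    weightedSum wV VP (λ f → weightedSum wV VP (λ g → φ (joinVP (f , g)))) ∎
    where
    open ≡-Reasoning
    VP : List (Vertex n → Bool)
    VP = allVertexPreds n
    wV : (Vertex n → Bool) → ℚ
    wV = bernoulliWeight p (allVertices n)
    wV′ : (Vertex (suc n) → Bool) → ℚ
    wV′ = bernoulliWeight p (allVertices (suc n))

  subgraphSpace-suc : ∀ n φ → Invariant (subgraphSpace (suc n)) φ →
    𝔼 (subgraphSpace (suc n)) φ
      ≡ 𝔼 (vertexPredSpace n ⊗ (subgraphSpace n ⊗ subgraphSpace n)) (φ ∘ joinSubgraph)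
  subgraphSpace-suc n φ φ-inv = begin
    weightedSum (weight p) (allSubgraphs (suc n)) φ
      ≡⟨ 𝔼-bernoulli-Pointwise {ds = allEdges (suc n)} φ-inv (allSubgraphs-suc n) ⟩
    weightedSum (weight p)
      (concatMap (λ f → concatMap (λ g → map (λ h → joinSubgraph (f , g , h)) S) S) VP) φ
      ≡⟨ weightedSum-concatMap fiber VP ⟩
    weightedSum wV VP (λ f → 𝔼S² (λ (g , h) → φ (joinSubgraph (f , g , h)))) ∎
    where
    open ≡-Reasoning
    S : List (Subgraph n)
    S = allSubgraphs n
    VP : List (Vertex n → Bool)
    VP = allVertexPreds n
    wV : (Vertex n → Bool) → ℚ
    wV = bernoulliWeight p (allVertices n)
    𝔼S² : (Subgraph n × Subgraph n → ℚ) → ℚ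
    𝔼S² = 𝔼 (subgraphSpace n ⊗ subgraphSpace n)
    fiber : ∀ f →
      weightedSum (weight p) (concatMap (λ g → map (λ h → joinSubgraph (f , g , h)) S) S) φ
        ≡ wV f * 𝔼S² (λ (g , h) → φ (joinSubgraph (f , g , h)))
    fiber f = begin
      weightedSum (weight p) (concatMap (λ g → map (λ h → joinSubgraph (f , g , h)) S) S) φ
        ≡⟨ weightedSum-concatMap (λ g →
             weightedSum-map {v = weight p} {a = wV f * weight p g} (weight-split g) S) S ⟩
      weightedSum (λ g → wV f * weight p g) S
        (λ g → weightedSum (weight p) S (λ h → φ (joinSubgraph (f , g , h))))
        ≡⟨ weightedSum-scale (wV f) S ⟩
      wV f * 𝔼S² (λ (g , h) → φ (joinSubgraph (f , g , h))) ∎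
      where
      weight-split : ∀ g h →
        weight p (joinSubgraph (f , g , h)) ≡ (wV f * weight p g) * weight p h
      weight-split g h =
        trans (weight-joinSubgraph p f g h) (sym (*-assoc (wV f) (weight p g) (weight p h)))

  vertexPredSpace-zero : ∀ φ →
    𝔼 (vertexPredSpace 0) φ ≡ (1ℚ - p) * φ (λ _ → false) + p * φ (λ _ → true)
  vertexPredSpace-zero φ =
    cong₂ _+_ (cong (_* φ (λ _ → false)) (*-identityʳ (1ℚ - p)))
              (trans (+-identityʳ _) (cong (_* φ (λ _ → true)) (*-identityʳ p)))

  harris-vertexPredSpace : ∀ n → Harris (vertexPredSpace n)
  harris-vertexPredSpace zero f g f↓ g↑ =
    subst₂ _≤_ (sym (vertexPredSpace-zero (λ F → f F * g F)))
               (sym (cong₂ _*_ (vertexPredSpace-zero f) (vertexPredSpace-zero g)))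
               (two-point-harris 0≤p p≤1 (f↓ ∅⊆full) (g↑ ∅⊆full))
    where
    ∅⊆full : (λ _ → false) ⊆ᵇ (λ _ → true)
    ∅⊆full _ ()
  harris-vertexPredSpace (suc n) =
    harris-pushforward (vertexPredSpace n ⊗ vertexPredSpace n) (vertexPredSpace (suc n))
      joinVP (λ (f⊆f′ , g⊆g′) → joinVP-mono f⊆f′ g⊆g′) (vertexPredSpace-suc n)
      (harris-⊗ (vertexPredSpace n) (vertexPredSpace n)
        (harris-vertexPredSpace n) (harris-vertexPredSpace n))

  subgraphSpace-zero : ∀ φ → 𝔼 (subgraphSpace 0) φ ≡ φ (λ ())
  subgraphSpace-zero φ = trans (+-identityʳ _) (*-identityˡ _)

  harris-subgraphSpace : ∀ n → Harris (subgraphSpace n)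
  harris-subgraphSpace zero f g f↓ g↑ = ≤-reflexive
    (trans (subgraphSpace-zero (λ H → f H * g H))
           (sym (cong₂ _*_ (subgraphSpace-zero f) (subgraphSpace-zero g))))
  harris-subgraphSpace (suc n) =
    harris-pushforward (vertexPredSpace n ⊗ (subgraphSpace n ⊗ subgraphSpace n))
      (subgraphSpace (suc n)) joinSubgraph
      (λ (f⊆f′ , g⊆g′ , h⊆h′) → joinSubgraph-mono f⊆f′ g⊆g′ h⊆h′) (subgraphSpace-suc n)
      (harris-⊗ (vertexPredSpace n) (subgraphSpace n ⊗ subgraphSpace n)
        (harris-vertexPredSpace n)
        (harris-⊗ (subgraphSpace n) (subgraphSpace n)
          (harris-subgraphSpace n) (harris-subgraphSpace n)))

indicator : Bool → ℚ
indicator b = if b then 1ℚ else 0ℚ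

indicator-∧ : ∀ a b → indicator (a ∧ b) ≡ indicator a * indicator b
indicator-∧ true  b = sym (*-identityˡ _)
indicator-∧ false b = sym (*-zeroˡ (indicator b))

indicator-isYes-mono : {P Q : Set} → (P → Q) → (P? : Dec P) (Q? : Dec Q) →
  indicator (isYes P?) ≤ indicator (isYes Q?)
indicator-isYes-mono P⇒Q (yes p) (yes q) = ≤-refl
indicator-isYes-mono P⇒Q (yes p) (no ¬q) = contradiction (P⇒Q p) ¬q
indicator-isYes-mono P⇒Q (no ¬p) (yes q) = nonNegative⁻¹ 1ℚ
indicator-isYes-mono P⇒Q (no ¬p) (no ¬q) = ≤-refl

if-then-0≡*indicator : ∀ w b → (if b then w else 0ℚ) ≡ w * indicator b
if-then-0≡*indicator w true  = sym (*-identityʳ w)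
if-then-0≡*indicator w false = sym (*-zeroʳ w)

sumℚ-if≡weightedSum : (w : X → ℚ) (χ : X → Bool) → ∀ xs →
  sumℚ (map (λ x → if χ x then w x else 0ℚ) xs) ≡ weightedSum w xs (indicator ∘ χ)
sumℚ-if≡weightedSum w χ []       = refl
sumℚ-if≡weightedSum w χ (x ∷ xs) =
  cong₂ _+_ (if-then-0≡*indicator (w x) (χ x)) (sumℚ-if≡weightedSum w χ xs)

module _ {n : ℕ} {H H′ : Subgraph n} (H⊆H′ : H ⊆E H′) where

  IsEmbedding-antitone : ∀ {π} → IsEmbedding H′ π → IsEmbedding H π
  IsEmbedding-antitone embeds e e∈H = embeds e (H⊆H′ e e∈H)

  ⊆Ẽ-mono : ∀ {A : EdgeSet n} → A ⊆Ẽ H → A ⊆Ẽ H′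
  ⊆Ẽ-mono A⊆H̃ e e∈A with A⊆H̃ e e∈A
  ... | inj₁ e∈H   = inj₁ (H⊆H′ e e∈H)
  ... | inj₂ solid = inj₂ (λ π embeds → solid π (IsEmbedding-antitone {π} embeds))

  InP-antitone : ∀ {k} {B : Fin k → EdgeSet n} → InP B H′ → InP B H
  InP-antitone H′∈P i Bᵢ⊆H = H′∈P i (λ e e∈Bᵢ → H⊆H′ e (Bᵢ⊆H e e∈Bᵢ))

lemma4 : (n : ℕ) (p : ℚ) → 0ℚ ≤ p → p ≤ 1ℚ →
    (A : EdgeSet n) (k : ℕ) (B : Fin k → EdgeSet n) → PairwiseDisjoint B →
    Σ (Subgraph n) (λ H → InP B H × A ⊆Ẽ H) →
    (P? : (H : Subgraph n) → Dec (InP B H)) →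
    (E? : (H : Subgraph n) → Dec (A ⊆Ẽ H)) →
    Pr n p (λ H → isYes (P? H) ∧ isYes (E? H))
      ≤ Pr n p (λ H → isYes (P? H)) * Pr n p (λ H → isYes (E? H))
lemma4 n p 0≤p p≤1 A k B _ _ P? E? = begin
  Pr n p (λ H → isYes (P? H) ∧ isYes (E? H))
    ≡⟨ sumℚ-if≡weightedSum (weight p) _ (allSubgraphs n) ⟩
  𝔼 (subgraphSpace n) (λ H → indicator (isYes (P? H) ∧ isYes (E? H)))
    ≡⟨ 𝔼-cong (subgraphSpace n) (λ H → indicator-∧ (isYes (P? H)) (isYes (E? H))) ⟩
  𝔼 (subgraphSpace n) (λ H → 𝟙P H * 𝟙E H)
    ≤⟨ harris-subgraphSpace n 𝟙P 𝟙E
         (λ H⊆H′ → indicator-isYes-mono (InP-antitone H⊆H′) (P? _) (P? _))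
         (λ H⊆H′ → indicator-isYes-mono (⊆Ẽ-mono H⊆H′) (E? _) (E? _)) ⟩
  𝔼 (subgraphSpace n) 𝟙P * 𝔼 (subgraphSpace n) 𝟙E
    ≡⟨ cong₂ _*_ (sumℚ-if≡weightedSum (weight p) _ (allSubgraphs n))
                 (sumℚ-if≡weightedSum (weight p) _ (allSubgraphs n)) ⟨
  Pr n p (λ H → isYes (P? H)) * Pr n p (λ H → isYes (E? H)) ∎
  where
  open ≤-Reasoning
  open Bernoulli p 0≤p p≤1
  𝟙P 𝟙E : Subgraph n → ℚ
  𝟙P H = indicator (isYes (P? H))
  𝟙E H = indicator (isYes (E? H))
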